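{- Let $\vec x$, $\vec y$ be variable vectors with $\vec y\not\equiv\vec x$, let $\vec h\in\mathcal C^{\vec x}$, and let $\vec f\in\mathcal C^{\vec x}$ be $x$-free of the same level as $\vec y$. Then $(\delta^{\vec x}\vec h)\{\vec y:=\vec f\}=\delta^{\vec x}(\vec h\{\vec y:=\vec f\})$.
   Context: Ordinals: $\oplus,\otimes$ natural sum/product below $\varepsilon_0$; $2^\alpha:=\omega^{\alpha_0}2^k$ for $\alpha=\omega\alpha_0+k$; $\mathrm{no}(0)=0$, $\mathrm{no}(\omega^{\alpha_1}+\dots+\omega^{\alpha_k})=k+\sum_i\mathrm{no}(\alpha_i)$; $F_0(x)=2^x$, $F_{j+1}(x)=F_j^{x+1}(x)$, $\Phi(x)=F_5(x+100)$; $\psi(\alpha)=\max(\{0\}\cup\{\psi(\beta)+1:\beta<\alpha,\mathrm{no}(\beta)\le\Phi(\mathrm{no}(\alpha))\})$. Each typed variable $X^\sigma$ has a vector $\vec x=\langle x_0,\dots,x_{\mathrm{lv}(\sigma)}\rangle$ of distinct ordinal variables (disjoint for distinct variables). Ordinal terms: ordinal variables, $0,1,\omega$, $f+g$, $2^f\cdot g$, $\psi(\omega f+g)$; closed terms denote ordinals ($+$ as $\oplus$, $\cdot$ as $\otimes$). $h$ (or a vector) is $x$-free if no $x_i$ occurs. Vectors: level-$n$ tuples, $h_i=0$ beyond level, componentwise sums, $2\vec v=\vec v+\vec v$, $\{\vec y:=\vec a\}$ replaces each $y_i$ by $a_i$, $\vec1=\langle1,\dots,1\rangle$. $\mathcal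 B_i$: $1\in\mathcal B_i$; $\omega\in\mathcal B_i$ ($i\ge1$); closed under $+$; $2^fg\in\mathcal B_i$ if $f\in\mathcal B_{i+1},g\in\mathcal B_i,i\ge1$; $\psi(\omega f+g)\in\mathcal B_0$ if $f\in\mathcal B_1,g\in\mathcal B_0,\mathrm{no}(f)\le F_2(g)$; $\mathcal B_0\subseteq\mathcal B_i$. $\preceq$: holds under every substitution of the variable vectors by $\mathcal B$-vectors of bounded norm ($\mathrm{no}(f_i)\le\mathrm{no}(f_0)$); equality $=$ likewise (extensional). $\mathcal C^{\vec x}_i$: $1\in\mathcal C^{\vec x}_i$; $\omega\in\mathcal C^{\vec x}_i$ ($i\ge1$); $y^\rho_i\in\mathcal C^{\vec x}_i$ for every variable $Y^\rho$, $i\le\mathrm{lv}(\rho)$; closed under $+$; $2^fg\in\mathcal C^{\vec x}_i$ if $f\in\mathcal C^{\vec x}_{i+1},g\in\mathcal C^{\vec x}_i,i\ge1$; $\psi(\omega f+g)\in\mathcal C^{\vec x}_0$ if $f\in\mathcal C^{\vec x}_1,g\in\mathcal C^{\vec x}_0,\mathrm{no}(f)\preceq F_2(g)$; $x$-free members of $\mathcal C^{\vec x}_0$ belong to all $\mathcal C^{\vec x}_i$. $\mathcal C^{\vec x}$: vectors with $h_i\in\mathcal C^{\vec x}_i$. $\delta^{\vec x}$ ($n:=\mathrm{lv}(\vec x)+1$): $\delta^{\vec x}_ih$ for $h\in\mathcal C^{\vec x}_i$ is a level-$n$ vector: $x$-free $h$: component $i$ is $h+1$, others $1$; $h\equiv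 x_i$: $\vec1$; $h\equiv f+g$: $\delta^{\vec x}_if+\delta^{\vec x}_ig+\vec1$; $h\equiv2^fg$ ($i>0$): $2\delta^{\vec x}_{i+1}f+\delta^{\vec x}_ig+\vec1$; $h\equiv\psi(\omega f+g)$ ($i=0$): component $0$ is $\psi(\omega f\{\vec x:=\vec1\}+(\delta^{\vec x}_0g)_0)$, component $j\ge1$ is $(\delta^{\vec x}_1f)_j+(\delta^{\vec x}_0g)_j$. $\mathrm{sz}^{\vec x}(h)=1$ if $h$ is $x$-free or some $x_i$; $\mathrm{sz}^{\vec x}(f)+\mathrm{sz}^{\vec x}(g)+1$ for non-$x$-free $f+g$ or $\psi(\omega f+g)$; $2\mathrm{sz}^{\vec x}(f)+\mathrm{sz}^{\vec x}(g)+1$ for non-$x$-free $2^fg$. For $\vec h\in\mathcal C^{\vec x}$ of level $m$: $\delta^{\vec x}\vec h$ has level $\max(n,m)$ with $(\delta^{\vec x}\vec h)_0=2^n(\sum_{i\le m}\mathrm{sz}^{\vec x}(h_i))(\delta^{\vec x}_0h_0)_0$, $(\delta^{\vec x}\vec h)_j=\sum_{i\le m}(\delta^{\vec x}_ih_i)_j$ ($0<j\le n$), $=h_j$ ($j>n$). -}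

module Defs where

open import Data.Nat using (ℕ; zero; suc; _+_; _*_; _^_; _≤_; _⊔_; _≤ᵇ_; _≡ᵇ_)
open import Data.Nat.Properties using (_≟_)
open import Data.Bool using (Bool; true; false; if_then_else_; _∧_; _∨_; not)
open import Data.List using (List; []; _∷_; foldr; filterᵇ; concatMap)
open import Data.List.Relation.Binary.Pointwise using (Pointwise)
open import Data.Product using (_×_; _,_)
open import Relation.Binary.PropositionalEquality using (_≡_)
open import Relation.Nullary using (does)
open import Relation.Nullary.Negation using (¬_)

-- Ordinals below ε₀ in Cantor normal form:  ω^ a + b  (exponents
-- non-increasing; all values produced below are in normal form).

infixr 5 ω^_+_
data O : Set where
  𝟎     : O
  ω^_+_ : O → O → O

data Cmp : Set where
  lt eq gt : Cmp

cmp : O → O → Cmp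
cmp 𝟎 𝟎 = eq
cmp 𝟎 (ω^ _ + _) = lt
cmp (ω^ _ + _) 𝟎 = gt
cmp (ω^ a + b) (ω^ c + d) with cmp a c
... | lt = lt
... | gt = gt
... | eq = cmp b d

isLt : O → O → Bool
isLt a b with cmp a b
... | lt = true
... | _  = false

headLe : O → O → Bool
headLe 𝟎 _ = true
headLe (ω^ c + _) a = not (isLt a c)

nf : O → Bool
nf 𝟎 = true
nf (ω^ a + b) = nf a ∧ nf b ∧ headLe b a

infixl 6 _⊕_
_⊕_ : O → O → O
𝟎 ⊕ y = y
(ω^ a + b) ⊕ 𝟎 = ω^ a + b
(ω^ a + b) ⊕ (ω^ c + d) =
  if isLt a c then ω^ c + ((ω^ a + b) ⊕ d) else ω^ a + (b ⊕ (ω^ c + d))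

mulTerm : O → O → O
mulTerm a 𝟎 = 𝟎
mulTerm a (ω^ c + d) = (ω^ (a ⊕ c) + 𝟎) ⊕ mulTerm a d

infixl 7 _⊗_
_⊗_ : O → O → O
𝟎 ⊗ y = 𝟎
(ω^ a + b) ⊗ y = mulTerm a y ⊕ (b ⊗ y)

no : O → ℕ
no 𝟎 = 0
no (ω^ a + b) = suc (no a + no b)

rep : ℕ → O → O
rep zero a = 𝟎
rep (suc m) a = ω^ a + rep m a

nat : ℕ → O
nat n = rep n 𝟎

oone oω : O
oone = nat 1
oω = ω^ oone + 𝟎

-- the finite part k of α = ωα₀ + k
fin : O → ℕ
fin 𝟎 = 0
fin (ω^ 𝟎 + r) = suc (fin r)
fin (ω^ (ω^ _ + _) + r) = fin r

-- e' with 1 + e' = e (for e ≠ 0)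
predExp : O → O
predExp (ω^ 𝟎 + r) = r
predExp e = e

-- α₀ with α = ωα₀ + k
divω : O → O
divω 𝟎 = 𝟎
divω (ω^ 𝟎 + _) = 𝟎
divω (ω^ (ω^ a + b) + r) = ω^ predExp (ω^ a + b) + divω r

two^ : O → O
two^ α = rep (2 ^ fin α) (divω α)

iter : (ℕ → ℕ) → ℕ → ℕ → ℕ
iter f zero x = x
iter f (suc k) x = f (iter f k x)

F : ℕ → ℕ → ℕ
F zero x = 2 ^ x
F (suc j) x = iter (F j) (suc x) x

Φ : ℕ → ℕ
Φ x = F 5 (x + 100)

-- ψ, given by its (inductively defined) graph Ψ α n  ("ψ(α) = n").
-- T n lists (at least) all ordinal trees of norm ≤ n.

T : ℕ → List O
T zero = 𝟎 ∷ []
T (suc n) = 𝟎 ∷ concatMap (λ a → concatMap (λ b →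
              if no a + no b ≤ᵇ n then (ω^ a + b) ∷ [] else []) (T n)) (T n)

preds : O → List O
preds α = filterᵇ (λ β → nf β ∧ isLt β α) (T (Φ (no α)))

maxSuc : List ℕ → ℕ
maxSuc = foldr (λ m acc → suc m ⊔ acc) 0

data Ψ : O → ℕ → Set where
  mkΨ : ∀ {α} (ms : List ℕ) → Pointwise Ψ (preds α) ms → Ψ α (maxSuc ms)

-- Typed variables (abstracted to their level) and ordinal terms

record Var : Set where
  constructor mkVar
  field
    lvl : ℕ     -- lv(σ) of the type of the variable
    idx : ℕ
open Var public

_≟V_ : Var → Var → Bool
mkVar l i ≟V mkVar l' i' = does (l ≟ l') ∧ does (i ≟ i')

infixl 6 _+ᵗ_
data Tm : Set where
  var   : Var → ℕ → Tm      -- var Y i  is the ordinal variable y_i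
  𝟘 𝟙 ω̂ : Tm
  _+ᵗ_  : Tm → Tm → Tm
  2^_·_ : Tm → Tm → Tm
  ψω_+_ : Tm → Tm → Tm

-- evaluation of closed terms (+ as ⊕, · as ⊗)
infix 4 _⇓_
data _⇓_ : Tm → O → Set where
  e𝟘 : 𝟘 ⇓ 𝟎
  e𝟙 : 𝟙 ⇓ oone
  eω : ω̂ ⇓ oω
  e+ : ∀ {f g a b} → f ⇓ a → g ⇓ b → f +ᵗ g ⇓ a ⊕ b
  e2 : ∀ {f g a b} → f ⇓ a → g ⇓ b → 2^ f · g ⇓ two^ a ⊗ b
  eψ : ∀ {f g a b n} → f ⇓ a → g ⇓ b → Ψ (oω ⊗ a ⊕ b) n → ψω f + g ⇓ nat n

data B : ℕ → Tm → Set where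
  b𝟙 : ∀ {i} → B i 𝟙
  bω : ∀ {i} → B (suc i) ω̂
  b+ : ∀ {i f g} → B i f → B i g → B i (f +ᵗ g)
  b2 : ∀ {i f g} → B (suc (suc i)) f → B (suc i) g → B (suc i) (2^ f · g)
  bψ : ∀ {f g} → B 1 f → B 0 g →
       (∀ a b → f ⇓ a → g ⇓ b → no a ≤ F 2 (fin b)) → B 0 (ψω f + g)
  b0 : ∀ {i h} → B 0 h → B i h

Sub : Set
Sub = Var → ℕ → Tm

sub : Sub → Tm → Tm
sub σ (var Y i) = σ Y i
sub σ 𝟘 = 𝟘
sub σ 𝟙 = 𝟙
sub σ ω̂ = ω̂
sub σ (f +ᵗ g) = sub σ f +ᵗ sub σ g
sub σ (2^ f · g) = 2^ sub σ f · sub σ g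
sub σ (ψω f + g) = ψω sub σ f + sub σ g

Adm : Sub → Set
Adm σ = ∀ Y i → i ≤ lvl Y →
  B i (σ Y i) × (∀ a₀ aᵢ → σ Y 0 ⇓ a₀ → σ Y i ⇓ aᵢ → no aᵢ ≤ no a₀)

infix 4 _≈_
_≈_ : Tm → Tm → Set
s ≈ t = ∀ σ → Adm σ → ∀ v → (sub σ s ⇓ v → sub σ t ⇓ v) × (sub σ t ⇓ v → sub σ s ⇓ v)

NoPrec : Tm → Tm → Set
NoPrec f g = ∀ σ → Adm σ → ∀ a b → sub σ f ⇓ a → sub σ g ⇓ b → no a ≤ F 2 (fin b)

occurs : Var → Tm → Bool
occurs x (var Y i) = x ≟V Y
occurs x 𝟘 = false
occurs x 𝟙 = false
occurs x ω̂ = false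
occurs x (f +ᵗ g) = occurs x f ∨ occurs x g
occurs x (2^ f · g) = occurs x f ∨ occurs x g
occurs x (ψω f + g) = occurs x f ∨ occurs x g

XFree : Var → Tm → Set
XFree x h = occurs x h ≡ false

data C (x : Var) : ℕ → Tm → Set where
  c𝟙   : ∀ {i} → C x i 𝟙
  cω   : ∀ {i} → C x (suc i) ω̂
  cvar : ∀ {Y i} → i ≤ lvl Y → C x i (var Y i)
  c+   : ∀ {i f g} → C x i f → C x i g → C x i (f +ᵗ g)
  c2   : ∀ {i f g} → C x (suc (suc i)) f → C x (suc i) g → C x (suc i) (2^ f · g)
  cψ   : ∀ {f g} → C x 1 f → C x 0 g → NoPrec f g → C x 0 (ψω f + g)
  cfree : ∀ {i h} → XFree x h → C x 0 h → C x i h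

-- Vectors of terms: level and components; components beyond the level are 0

record TV : Set where
  constructor mkTV
  field
    lev : ℕ
    at  : ℕ → Tm
open TV public

comp : TV → ℕ → Tm
comp v i = if i ≤ᵇ lev v then at v i else 𝟘

InC : Var → TV → Set
InC x h = ∀ i → i ≤ lev h → C x i (comp h i)

XFreeV : Var → TV → Set
XFreeV x h = ∀ i → i ≤ lev h → XFree x (comp h i)

infix 4 _≈V_
_≈V_ : TV → TV → Set
u ≈V v = (lev u ≡ lev v) × (∀ i → i ≤ lev u → comp u i ≈ comp v i)

infixl 6 _⊕v_
_⊕v_ : TV → TV → TV
u ⊕v v = mkTV (lev u ⊔ lev v) (λ j → comp u j +ᵗ comp v j)

vone : ℕ → TV
vone n = mkTV n (λ _ → 𝟙)

subst : Var → TV → Tm → Tm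
subst y a = sub (λ Z i → if y ≟V Z then comp a i else var Z i)

substV : Var → TV → TV → TV
substV y a h = mkTV (lev h) (λ i → subst y a (at h i))

module _ (x : Var) where
  private
    n : ℕ
    n = suc (lvl x)

  baseδ : ℕ → Tm → TV
  baseδ i h = mkTV n (λ j → if j ≡ᵇ i then h +ᵗ 𝟙 else 𝟙)

  guard : ℕ → Tm → TV → TV
  guard i h r = if occurs x h then r else baseδ i h

  δi : ℕ → Tm → TV
  δi i h@(var _ _) = guard i h (vone n)
  δi i h@𝟘 = guard i h (vone n)
  δi i h@𝟙 = guard i h (vone n)
  δi i h@ω̂ = guard i h (vone n)
  δi i h@(f +ᵗ g) = guard i h (δi i f ⊕v δi i g ⊕v vone n)
  δi i h@(2^ f · g) = guard i h (δi (suc i) f ⊕v δi (suc i) f ⊕v δi i g ⊕v vone n)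
  δi i h@(ψω f + g) = guard i h (mkTV n λ
      { zero → ψω (subst x (vone (lvl x)) f) + comp (δi 0 g) 0
      ; (suc j) → comp (δi 1 f) (suc j) +ᵗ comp (δi 0 g) (suc j) })

  sz : Tm → ℕ
  sz h@(f +ᵗ g) = if occurs x h then sz f + sz g + 1 else 1
  sz h@(2^ f · g) = if occurs x h then 2 * sz f + sz g + 1 else 1
  sz h@(ψω f + g) = if occurs x h then sz f + sz g + 1 else 1
  sz _ = 1

  Σt : (ℕ → Tm) → ℕ → Tm
  Σt t zero = t 0
  Σt t (suc k) = Σt t k +ᵗ t (suc k)

  Σn : (ℕ → ℕ) → ℕ → ℕ
  Σn t zero = t 0
  Σn t (suc k) = Σn t k + t (suc k)

  mulN : ℕ → Tm → Tm
  mulN zero t = 𝟘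
  mulN (suc zero) t = t
  mulN (suc (suc k)) t = mulN (suc k) t +ᵗ t

  δV : TV → TV
  δV h = mkTV (n ⊔ m) λ
      { zero → mulN (2 ^ n * Σn (λ i → sz (comp h i)) m) (comp (δi 0 (comp h 0)) 0)
      ; (suc j) → if suc j ≤ᵇ n then Σt (λ i → comp (δi i (comp h i)) (suc j)) m
                  else comp h (suc j) }
    where m = lev h

-- A substitution that fixes the variables of x and otherwise substitutes
-- x-free terms (such as {y := f} for y ≢ x) neither creates nor destroys
-- occurrences of x.  Hence it preserves x-freeness and sz^x and commutes with
-- the substitution {x := 1} of the ψ-clause; since every clause of δ^x is built
-- from these by sums of vectors, δ^x commutes with it componentwise, even
-- syntactically.
module Submission where

open import Defs
open import Relation.Binary.PropositionalEquality using (_≡_)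
open import Relation.Nullary.Negation using (¬_)

open import Data.Bool using (true; false; if_then_else_; _∨_)
open import Data.Bool.Properties using (if-float)
open import Data.Nat using (ℕ; zero; suc; _+_; _*_; _^_; _≤ᵇ_; _≡ᵇ_)
open import Data.Nat.Properties using (_≟_; ≤ᵇ-reflects-≤)
open import Function using (id)
open import Data.Product using (_×_; _,_; proj₂)
open import Relation.Binary.PropositionalEquality
  using (_≢_; ≢-sym; refl; sym; trans; cong; cong₂; module ≡-Reasoning)
open import Relation.Nullary using (proof)
open import Relation.Nullary.Reflects using (Reflects; ofʸ; ofⁿ; det; _×-reflects_)

≟V-reflects : ∀ u v → Reflects (u ≡ v) (u ≟V v)
≟V-reflects (mkVar l i) (mkVar l′ i′) =
  mkVar-reflects (proof (l ≟ l′) ×-reflects proof (i ≟ i′))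
  where
  mkVar-reflects : ∀ {b} → Reflects ((l ≡ l′) × (i ≡ i′)) b →
                   Reflects (mkVar l i ≡ mkVar l′ i′) b
  mkVar-reflects (ofʸ (refl , refl)) = ofʸ refl
  mkVar-reflects (ofⁿ ≢) = ofⁿ λ { refl → ≢ (refl , refl) }

≟V-refl : ∀ u → (u ≟V u) ≡ true
≟V-refl u = det (≟V-reflects u u) (ofʸ refl)

≢⇒≟V-false : ∀ {u v} → u ≢ v → (u ≟V v) ≡ false
≢⇒≟V-false {u} {v} u≢v = det (≟V-reflects u v) (ofⁿ u≢v)

∨-false : ∀ a b → a ∨ b ≡ false → (a ≡ false) × (b ≡ false)
∨-false false b e = refl , e
∨-false true b ()

≡⇒≈ : ∀ {s t} → s ≡ t → s ≈ t
≡⇒≈ refl σ _ v = id , id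

subst-free : ∀ x a t → XFree x t → subst x a t ≡ t
subst-free x a (var Z k) e rewrite e = refl
subst-free x a 𝟘 e = refl
subst-free x a 𝟙 e = refl
subst-free x a ω̂ e = refl
subst-free x a (f +ᵗ g) e with ∨-false (occurs x f) (occurs x g) e
... | ef , eg = cong₂ _+ᵗ_ (subst-free x a f ef) (subst-free x a g eg)
subst-free x a (2^ f · g) e with ∨-false (occurs x f) (occurs x g) e
... | ef , eg = cong₂ 2^_·_ (subst-free x a f ef) (subst-free x a g eg)
subst-free x a (ψω f + g) e with ∨-false (occurs x f) (occurs x g) e
... | ef , eg = cong₂ ψω_+_ (subst-free x a f ef) (subst-free x a g eg)

sz-free : ∀ x t → XFree x t → sz x t ≡ 1
sz-free x (var _ _) e = refl
sz-free x 𝟘 e = refl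
sz-free x 𝟙 e = refl
sz-free x ω̂ e = refl
sz-free x (f +ᵗ g) e rewrite e = refl
sz-free x (2^ f · g) e rewrite e = refl
sz-free x (ψω f + g) e rewrite e = refl

δi-free : ∀ x i t → XFree x t → δi x i t ≡ baseδ x i t
δi-free x i (var Z k) e rewrite e = refl
δi-free x i 𝟘 e = refl
δi-free x i 𝟙 e = refl
δi-free x i ω̂ e = refl
δi-free x i (f +ᵗ g) e rewrite e = refl
δi-free x i (2^ f · g) e rewrite e = refl
δi-free x i (ψω f + g) e rewrite e = refl

sub-comp-vone : ∀ σ l k → sub σ (comp (vone l) k) ≡ comp (vone l) k
sub-comp-vone σ l k with k ≤ᵇ l
... | true = refl
... | false = refl

subV : Sub → TV → TV
subV σ h = mkTV (lev h) (λ i → sub σ (at h i))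

comp-subV : ∀ σ h i → comp (subV σ h) i ≡ sub σ (comp h i)
comp-subV σ h i with i ≤ᵇ lev h
... | true = refl
... | false = refl

sub-mulN : ∀ x σ k t → sub σ (mulN x k t) ≡ mulN x k (sub σ t)
sub-mulN x σ zero t = refl
sub-mulN x σ (suc zero) t = refl
sub-mulN x σ (suc (suc k)) t = cong (_+ᵗ sub σ t) (sub-mulN x σ (suc k) t)

sub-Σt : ∀ x σ T m → sub σ (Σt x T m) ≡ Σt x (λ i → sub σ (T i)) m
sub-Σt x σ T zero = refl
sub-Σt x σ T (suc m) = cong (_+ᵗ sub σ (T (suc m))) (sub-Σt x σ T m)

Σt-cong : ∀ x {T T′} → (∀ i → T i ≡ T′ i) → ∀ m → Σt x T m ≡ Σt x T′ m
Σt-cong x T≡T′ zero = T≡T′ 0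
Σt-cong x T≡T′ (suc m) = cong₂ _+ᵗ_ (Σt-cong x T≡T′ m) (T≡T′ (suc m))

Σn-cong : ∀ x {T T′} → (∀ i → T i ≡ T′ i) → ∀ m → Σn x T m ≡ Σn x T′ m
Σn-cong x T≡T′ zero = T≡T′ 0
Σn-cong x T≡T′ (suc m) = cong₂ _+_ (Σn-cong x T≡T′ m) (T≡T′ (suc m))

ImageV : Sub → TV → TV → Set
ImageV σ u v = (lev u ≡ lev v) × (∀ j → sub σ (comp u j) ≡ comp v j)

module _ {σ : Sub} where

  imageV-mkTV : ∀ {ℓ L L′} → (∀ j → sub σ (L j) ≡ L′ j) →
                ImageV σ (mkTV ℓ L) (mkTV ℓ L′)
  imageV-mkTV {ℓ} {L} {L′} sub-L = refl , sub-comp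
    where
    sub-comp : ∀ j → sub σ (comp (mkTV ℓ L) j) ≡ comp (mkTV ℓ L′) j
    sub-comp j with j ≤ᵇ ℓ
    ... | true = sub-L j
    ... | false = refl

  imageV-⊕ : ∀ {u u′ v v′} → ImageV σ u u′ → ImageV σ v v′ →
             ImageV σ (u ⊕v v) (u′ ⊕v v′)
  imageV-⊕ {mkTV _ _} {mkTV _ _} {mkTV _ _} {mkTV _ _} (refl , su) (refl , sv) =
    imageV-mkTV λ j → cong₂ _+ᵗ_ (su j) (sv j)

  imageV-vone : ∀ l → ImageV σ (vone l) (vone l)
  imageV-vone l = imageV-mkTV λ _ → refl

  imageV-baseδ : ∀ x i t → ImageV σ (baseδ x i t) (baseδ x i (sub σ t))
  imageV-baseδ x i t = imageV-mkTV λ j → if-float (sub σ) (j ≡ᵇ i)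

  imageV-guard : ∀ x i t {r r′} → occurs x (sub σ t) ≡ occurs x t →
                 ImageV σ r r′ → ImageV σ (guard x i t r) (guard x i (sub σ t) r′)
  imageV-guard x i t occ r↦r′ rewrite occ with occurs x t
  ... | true = r↦r′
  ... | false = imageV-baseδ x i t

record XFreeSub (x : Var) (σ : Sub) : Set where
  field
    fixes  : ∀ k → σ x k ≡ var x k
    x-free : ∀ {Z} k → Z ≢ x → XFree x (σ Z k)

module _ {x : Var} {σ : Sub} (σ-x : XFreeSub x σ) where
  open XFreeSub σ-x

  private
    n : ℕ
    n = suc (lvl x)

    x:=1 : Tm → Tm
    x:=1 = subst x (vone (lvl x))

  occurs-sub : ∀ t → occurs x (sub σ t) ≡ occurs x t
  occurs-sub (var Z k) with x ≟V Z | ≟V-reflects x Z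
  ... | true  | ofʸ refl = trans (cong (occurs x) (fixes k)) (≟V-refl x)
  ... | false | ofⁿ x≢Z  = x-free k (≢-sym x≢Z)
  occurs-sub 𝟘 = refl
  occurs-sub 𝟙 = refl
  occurs-sub ω̂ = refl
  occurs-sub (f +ᵗ g) = cong₂ _∨_ (occurs-sub f) (occurs-sub g)
  occurs-sub (2^ f · g) = cong₂ _∨_ (occurs-sub f) (occurs-sub g)
  occurs-sub (ψω f + g) = cong₂ _∨_ (occurs-sub f) (occurs-sub g)

  sz-sub : ∀ t → sz x (sub σ t) ≡ sz x t
  sz-sub (var Z k) with x ≟V Z | ≟V-reflects x Z
  ... | true  | ofʸ refl = cong (sz x) (fixes k)
  ... | false | ofⁿ x≢Z  = sz-free x (σ Z k) (x-free k (≢-sym x≢Z))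
  sz-sub 𝟘 = refl
  sz-sub 𝟙 = refl
  sz-sub ω̂ = refl
  sz-sub (f +ᵗ g) rewrite occurs-sub f | occurs-sub g | sz-sub f | sz-sub g = refl
  sz-sub (2^ f · g) rewrite occurs-sub f | occurs-sub g | sz-sub f | sz-sub g = refl
  sz-sub (ψω f + g) rewrite occurs-sub f | occurs-sub g | sz-sub f | sz-sub g = refl

  sub-x:=1 : ∀ t → sub σ (x:=1 t) ≡ x:=1 (sub σ t)
  sub-x:=1 (var Z k) with x ≟V Z | ≟V-reflects x Z
  ... | true  | ofʸ refl = begin
    sub σ (comp (vone (lvl x)) k)   ≡⟨ sub-comp-vone σ (lvl x) k ⟩
    comp (vone (lvl x)) k           ≡⟨ cong (λ b → if b then comp (vone (lvl x)) k else var x k) (≟V-refl x) ⟨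
    x:=1 (var x k)                  ≡⟨ cong x:=1 (fixes k) ⟨
    x:=1 (σ x k)                    ∎
    where open ≡-Reasoning
  ... | false | ofⁿ x≢Z  =
    sym (subst-free x (vone (lvl x)) (σ Z k) (x-free k (≢-sym x≢Z)))
  sub-x:=1 𝟘 = refl
  sub-x:=1 𝟙 = refl
  sub-x:=1 ω̂ = refl
  sub-x:=1 (f +ᵗ g) = cong₂ _+ᵗ_ (sub-x:=1 f) (sub-x:=1 g)
  sub-x:=1 (2^ f · g) = cong₂ 2^_·_ (sub-x:=1 f) (sub-x:=1 g)
  sub-x:=1 (ψω f + g) = cong₂ ψω_+_ (sub-x:=1 f) (sub-x:=1 g)

  δi-sub : ∀ i t → ImageV σ (δi x i t) (δi x i (sub σ t))
  δi-sub i (var Z k) with x ≟V Z | ≟V-reflects x Z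
  ... | true  | ofʸ refl rewrite fixes k | ≟V-refl x = imageV-vone n
  ... | false | ofⁿ x≢Z  rewrite δi-free x i (σ Z k) (x-free k (≢-sym x≢Z)) =
    imageV-baseδ x i (var Z k)
  δi-sub i 𝟘 = imageV-baseδ x i 𝟘
  δi-sub i 𝟙 = imageV-baseδ x i 𝟙
  δi-sub i ω̂ = imageV-baseδ x i ω̂
  δi-sub i t@(f +ᵗ g) = imageV-guard x i t (occurs-sub t)
    (imageV-⊕ (imageV-⊕ (δi-sub i f) (δi-sub i g)) (imageV-vone n))
  δi-sub i t@(2^ f · g) = imageV-guard x i t (occurs-sub t)
    (imageV-⊕ (imageV-⊕ (imageV-⊕ (δi-sub (suc i) f) (δi-sub (suc i) f)) (δi-sub i g))
              (imageV-vone n))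
  δi-sub i t@(ψω f + g) = imageV-guard x i t (occurs-sub t) (imageV-mkTV λ
    { zero    → cong₂ ψω_+_ (sub-x:=1 f) (proj₂ (δi-sub 0 g) 0)
    ; (suc j) → cong₂ _+ᵗ_ (proj₂ (δi-sub 1 f) (suc j)) (proj₂ (δi-sub 0 g) (suc j)) })

  δV-sub : ∀ h → ImageV σ (δV x h) (δV x (subV σ h))
  δV-sub h = imageV-mkTV λ
    { zero → begin
        sub σ (mulN x (2 ^ n * Σn x (λ i → sz x (comp h i)) m) (comp (δi x 0 (comp h 0)) 0))
          ≡⟨ sub-mulN x σ (2 ^ n * Σn x (λ i → sz x (comp h i)) m) _ ⟩
        mulN x (2 ^ n * Σn x (λ i → sz x (comp h i)) m) (sub σ (comp (δi x 0 (comp h 0)) 0))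
          ≡⟨ cong₂ (mulN x) (cong (2 ^ n *_) (Σn-cong x sz-comp m)) (δi-comp 0 0) ⟩
        mulN x (2 ^ n * Σn x (λ i → sz x (comp h′ i)) m) (comp (δi x 0 (comp h′ 0)) 0)
          ∎
    ; (suc j) → trans (if-float (sub σ) (suc j ≤ᵇ n))
        (cong₂ (if_then_else_ (suc j ≤ᵇ n))
          (trans (sub-Σt x σ _ m) (Σt-cong x (λ i → δi-comp i (suc j)) m))
          (sym (comp-subV σ h (suc j)))) }
    where
    open ≡-Reasoning
    m : ℕ
    m = lev h
    h′ : TV
    h′ = subV σ h

    sz-comp : ∀ i → sz x (comp h i) ≡ sz x (comp h′ i)
    sz-comp i = trans (sym (sz-sub (comp h i))) (cong (sz x) (sym (comp-subV σ h i)))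

    δi-comp : ∀ i j → sub σ (comp (δi x i (comp h i)) j) ≡ comp (δi x i (comp h′ i)) j
    δi-comp i j = trans (proj₂ (δi-sub i (comp h i)) j)
                        (cong (λ t → comp (δi x i t) j) (sym (comp-subV σ h i)))

comp-xfree : ∀ {x f} → XFreeV x f → ∀ k → XFree x (comp f k)
comp-xfree {x} {f} f-free k with k ≤ᵇ lev f | ≤ᵇ-reflects-≤ k (lev f) | f-free k
... | true  | ofʸ k≤ | free = free k≤
... | false | ofⁿ _  | _    = refl

subst-XFreeSub : ∀ {x y f} → y ≢ x → XFreeV x f →
                 XFreeSub x (λ Z i → if y ≟V Z then comp f i else var Z i)
subst-XFreeSub {x} {y} {f} y≢x f-free = record { fixes = fixes ; x-free = x-free }
  where
  fixes : ∀ k → (if y ≟V x then comp f k else var x k) ≡ var x k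
  fixes k rewrite ≢⇒≟V-false y≢x = refl

  x-free : ∀ {Z} k → Z ≢ x → XFree x (if y ≟V Z then comp f k else var Z k)
  x-free {Z} k Z≢x with y ≟V Z
  ... | true  = comp-xfree f-free k
  ... | false = ≢⇒≟V-false (≢-sym Z≢x)

-- The identity holds syntactically in every component.
lemma2p20 : (x y : Var) → ¬ (y ≡ x) → (h f : TV) → InC x h →
    XFreeV x f → InC x f → lev f ≡ lvl y →
    substV y f (δV x h) ≈V δV x (substV y f h)
lemma2p20 x y y≢x h f _ f-free _ _ = refl , λ i _ → ≡⇒≈ (begin
    comp (substV y f (δV x h)) i  ≡⟨ comp-subV σ (δV x h) i ⟩
    sub σ (comp (δV x h) i)       ≡⟨ proj₂ (δV-sub (subst-XFreeSub y≢x f-free) h) i ⟩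
    comp (δV x (substV y f h)) i  ∎)
  where
  open ≡-Reasoning
  σ : Sub
  σ Z i = if y ≟V Z then comp f i else var Z i
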